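{- For each $l$, $1\le l\le h^+(\alpha)$, let $B_l$ be the $d\times d$ integer matrix whose $i$th column is the first column of $B_{li}$, i.e. $B_l$ has $(j,i)$ entry $b_{ij1l}$. Then $B_l\in\mathrm{GL}(d,\mathbb{Z})$.
   Context: Let $d\ge2$, let $F(X)=X^d+a_1X^{d-1}+\cdots+a_d\in\mathbb{Z}[X]$ be monic and irreducible, and let $\alpha$ be a root of $F$. Let $h^+(\alpha)$ be the narrow class number of $\mathbb{Z}[\alpha]$ and let $I_1=\mathbb{Z}[\alpha],I_2,\dots,I_{h^+(\alpha)}$ be fixed integral invertible ideals representing the narrow ideal classes of invertible ideals. Fix $\mathbb{Z}$-bases $\{\beta_{l1},\dots,\beta_{ld}\}$ of $I_l$ and $\{\overline{\beta}_{l1},\dots,\overline{\beta}_{ld}\}$ of $I_l^{ -1}$. Define integers $b_{ijkl}$ by $\overline{\beta}_{li}\beta_{lj}=\sum_{k=1}^db_{ijkl}\alpha^{d-k}$, and let $B_{li}$ be the $d\times d$ matrix with $(j,k)$ entry $b_{ijkl}$ ($j$ indexing rows, $k$ columns). -}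

module Defs where

open import Data.Nat as ℕ using (ℕ; zero; suc)
open import Data.Integer as ℤ using (ℤ; +_; -[1+_])
open import Data.Rational as ℚ using (ℚ; 0ℚ; 1ℚ)
open import Data.Fin using (Fin; zero; suc; fromℕ; inject₁)
open import Data.List using (List; []; _∷_; map)
open import Data.Product using (∃; _×_)
open import Data.Sum using (_⊎_)
open import Relation.Binary.PropositionalEquality using (_≡_)
open import Relation.Nullary using (¬_)

Σℤ : ∀ {n} → (Fin n → ℤ) → ℤ
Σℤ {zero}  f = + 0
Σℤ {suc n} f = f zero ℤ.+ Σℤ (λ i → f (suc i))

-- Polynomials over ℤ as coefficient lists (lowest degree first)

Poly : Set
Poly = List ℤ

coeff : Poly → ℕ → ℤ
coeff []       _       = + 0
coeff (a ∷ p)  zero    = a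
coeff (a ∷ p)  (suc n) = coeff p n

_⊕_ : Poly → Poly → Poly
[]      ⊕ q       = q
(a ∷ p) ⊕ []      = a ∷ p
(a ∷ p) ⊕ (b ∷ q) = (a ℤ.+ b) ∷ (p ⊕ q)

_⊗_ : Poly → Poly → Poly
[]      ⊗ q = []
(a ∷ p) ⊗ q = map (a ℤ.*_) q ⊕ (+ 0 ∷ (p ⊗ q))

-- equality of polynomials (ignoring trailing zeros)
_≈ₚ_ : Poly → Poly → Set
p ≈ₚ q = ∀ n → coeff p n ≡ coeff q n

IsUnitₚ : Poly → Set
IsUnitₚ p = ∃ λ q → (p ⊗ q) ≈ₚ (+ 1 ∷ [])

Irreducible : Poly → Set
Irreducible f =
  ¬ (f ≈ₚ []) × ¬ IsUnitₚ f ×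
  (∀ g h → (g ⊗ h) ≈ₚ f → IsUnitₚ g ⊎ IsUnitₚ h)

-- F(X) = X^d + c 0 + c 1 X + ... + c (d-1) X^(d-1)
--   (so c k = a_(d-k) in the paper's notation)
monicPoly : ∀ {d} → (Fin d → ℤ) → Poly
monicPoly {zero}  c = + 1 ∷ []
monicPoly {suc d} c = c zero ∷ monicPoly (λ k → c (suc k))

-- The algebra K = ℚ[X]/(F) = ℚ(α), elements written in the basis
-- 1, α, …, α^(d-1): x k is the coefficient of α^k.

K : ℕ → Set
K d = Fin d → ℚ

ℤtoℚ : ℤ → ℚ
ℤtoℚ z = z ℚ./ 1

_≋_ : ∀ {d} → K d → K d → Set
x ≋ y = ∀ k → x k ≡ y k

0K : ∀ {d} → K d
0K _ = 0ℚ

1K : ∀ {d} → K d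
1K zero    = 1ℚ
1K (suc k) = 0ℚ

_+K_ : ∀ {d} → K d → K d → K d
(x +K y) k = x k ℚ.+ y k

_•_ : ∀ {d} → ℚ → K d → K d
(q • x) k = q ℚ.* x k

ΣK : ∀ {d n} → (Fin n → K d) → K d
ΣK {n = zero}  f = 0K
ΣK {n = suc n} f = f zero +K ΣK (λ i → f (suc i))

top : ∀ {d} → K d → ℚ
top {zero}  x = 0ℚ
top {suc d} x = x (fromℕ d)

shiftK : ∀ {d} → K d → K d
shiftK {zero}  x ()
shiftK {suc d} x zero    = 0ℚ
shiftK {suc d} x (suc k) = x (inject₁ k)

-- multiplication by α, using α^d = - Σ_k c k α^k
mulα : ∀ {d} → (Fin d → ℤ) → K d → K d
mulα c x k = shiftK x k ℚ.- (top x ℚ.* ℤtoℚ (c k))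

powα : ∀ {d} → (Fin d → ℤ) → ℕ → K d → K d
powα c zero    x = x
powα c (suc n) x = mulα c (powα c n x)

mulK : ∀ {d} → (Fin d → ℤ) → K d → K d → K d
mulK c x y = ΣK (λ k → y k • powα c (Data.Fin.toℕ k) x)

InZα : ∀ {d} → K d → Set
InZα {d} x = ∃ λ (z : Fin d → ℤ) → ∀ k → x k ≡ ℤtoℚ (z k)

InSpan : ∀ {d n} → (Fin n → K d) → K d → Set
InSpan {n = n} v x = ∃ λ (z : Fin n → ℤ) → x ≋ ΣK (λ i → ℤtoℚ (z i) • v i)

ZIndependent : ∀ {d n} → (Fin n → K d) → Set
ZIndependent {n = n} v =
  ∀ (z : Fin n → ℤ) → ΣK (λ i → ℤtoℚ (z i) • v i) ≋ 0K → ∀ i → z i ≡ + 0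

IsIntegralIdealBasis : ∀ {d} → (Fin d → ℤ) → (Fin d → K d) → Set
IsIntegralIdealBasis {d} c β =
  ZIndependent β ×
  (∀ x → InSpan β x → InZα x) ×
  (∀ r x → InZα r → InSpan β x → InSpan β (mulK c r x))

IsInverseBasis : ∀ {d} → (Fin d → ℤ) → (Fin d → K d) → (Fin d → K d) → Set
IsInverseBasis {d} c β β' =
  ZIndependent β' ×
  (∀ x → InSpan β' x → (∀ y → InSpan β y → InZα (mulK c x y))) ×
  (∀ x → (∀ y → InSpan β y → InZα (mulK c x y)) → InSpan β' x)

-- I is invertible: I · I⁻¹ = ℤ[α], where I · I⁻¹ is the ℤ-span of
-- the products β'_i β_j
IsInvertible : ∀ {d} → (Fin d → ℤ) → (Fin d → K d) → (Fin d → K d) → Set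
IsInvertible {d} c β β' =
  ∀ x → (InZα x → ∃ λ (z : Fin d → Fin d → ℤ) →
                    x ≋ ΣK (λ i → ΣK (λ j → ℤtoℚ (z i j) • mulK c (β' i) (β j))))
      × ((∃ λ (z : Fin d → Fin d → ℤ) →
                    x ≋ ΣK (λ i → ΣK (λ j → ℤtoℚ (z i j) • mulK c (β' i) (β j))))
          → InZα x)

Matℤ : ℕ → Set
Matℤ d = Fin d → Fin d → ℤ

_·ℤ_ : ∀ {d} → Matℤ d → Matℤ d → Matℤ d
(A ·ℤ B) i j = Σℤ (λ k → A i k ℤ.* B k j)

Idℤ : ∀ {d} → Matℤ d
Idℤ zero    zero    = + 1
Idℤ zero    (suc j) = + 0
Idℤ (suc i) zero    = + 0
Idℤ (suc i) (suc j) = Idℤ i j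

InGL : ∀ {d} → Matℤ d → Set
InGL {d} A = ∃ λ (C : Matℤ d) → (∀ i j → (A ·ℤ C) i j ≡ Idℤ i j)
                              × (∀ i j → (C ·ℤ A) i j ≡ Idℤ i j)

module Submission where

-- The pairing (x , y) ↦ top (x · y), where top reads off the coefficient of
-- α^(d-1), is integral on I⁻¹ × I, and its matrix B_li = top (β'_i β_l) is
-- unimodular.  The proof is linear algebra in K = ℚ[X]/(F) written in the
-- basis 1, α, …, α^(d-1):
--   * K is a commutative ring (the product x · y = Σ_k y_k α^k x is linear
--     in x, and (v a) b = (v b) a), and ℤ[α] is closed under its operations;
--   * the elements dual k = Σ_s F_(k+1+s) α^s of ℤ[α] form the dual basis
--     for the pairing: top (dual k · y) = y_k;
--   * hence, if v ℤ[α] ⊆ span γ, multiplication by v is expressed in the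
--     coordinates of γ by functionals top (φ_m · _) with φ_m ∈ ℤ[α];
--   * if 1 = Σ_j u_j v_j with ℤ[α] u_j ⊆ span γ' and v_j ℤ[α] ⊆ span γ,
--     this produces a right inverse of the matrix top (γ'_i γ_l).
-- Writing 1 = Σ_ij w_ij β'_i β_j (invertibility of I) and grouping the sum
-- in the two possible ways gives a right inverse of B and of its transpose,
-- so B ∈ GL(d, ℤ).

open import Defs
open import Data.Nat using (ℕ; _≤_)
open import Data.Integer using (ℤ)
open import Data.Fin using (Fin)
open import Data.Product using (∃; _×_)
open import Relation.Binary.PropositionalEquality using (_≡_)

open import Level using (0ℓ)
open import Algebra.Bundles using (Semiring; CommutativeRing)
import Algebra.Properties.Semiring.Sum as SemiringSum
open import Relation.Binary.Bundles using (Setoid)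
import Relation.Binary.Reasoning.Setoid as SetoidReasoning
import Data.Nat as ℕ
import Data.Nat.Properties as ℕP
open import Data.Nat using (zero; suc)
open import Data.Integer as ℤ using (+_; -[1+_])
import Data.Integer.Properties as ℤP
open import Data.Rational as ℚ using (ℚ; mkℚ; 0ℚ; 1ℚ)
import Data.Rational.Properties as ℚP
open import Data.Rational.Solver using (module +-*-Solver)
import Data.Nat.Coprimality as Coprime
open import Data.Fin using (zero; suc; toℕ; fromℕ; inject₁)
open import Data.Fin.Properties using (toℕ-fromℕ; toℕ-inject₁; toℕ≤pred[n])
open import Data.Product using (_,_; proj₁; proj₂)
open import Function using (_∘_)
open import Relation.Binary.PropositionalEquality
  using (refl; sym; trans; cong; cong₂; module ≡-Reasoning)

module FiniteSums {c ℓ} (R : Semiring c ℓ) where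
  open Semiring R hiding (zero)
    renaming (refl to ≈-refl; sym to ≈-sym; trans to ≈-trans)
  open SemiringSum R public
  open SetoidReasoning setoid

  sum-reassoc : ∀ {m n} (x : Fin m → Carrier) (a : Fin m → Fin n → Carrier) (y : Fin n → Carrier) →
                sum (λ k → x k * sum (λ l → a k l * y l)) ≈ sum (λ l → sum (λ k → x k * a k l) * y l)
  sum-reassoc x a y = begin
    sum (λ k → x k * sum (λ l → a k l * y l))    ≈⟨ sum-cong-≋ (λ k → *-distribˡ-sum (x k) (λ l → a k l * y l)) ⟩
    sum (λ k → sum (λ l → x k * (a k l * y l)))  ≈⟨ sum-cong-≋ (λ k → sum-cong-≋ (λ l → ≈-sym (*-assoc (x k) (a k l) (y l)))) ⟩
    sum (λ k → sum (λ l → x k * a k l * y l))    ≈⟨ ∑-comm (λ k l → x k * a k l * y l) ⟩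
    sum (λ l → sum (λ k → x k * a k l * y l))    ≈⟨ sum-cong-≋ (λ l → ≈-sym (*-distribʳ-sum (y l) (λ k → x k * a k l))) ⟩
    sum (λ l → sum (λ k → x k * a k l) * y l)    ∎

  δ : ℕ → ℕ → Carrier
  δ zero    zero    = 1#
  δ zero    (suc n) = 0#
  δ (suc m) zero    = 0#
  δ (suc m) (suc n) = δ m n

  δ-< : ∀ {m n} → m ℕ.< n → δ m n ≈ 0#
  δ-< {zero}  {suc n} _             = ≈-refl
  δ-< {suc m} {suc n} (ℕ.s≤s m<n) = δ-< m<n

  sum-δˡ : ∀ {n} (i : Fin n) (f : Fin n → Carrier) →
           sum (λ k → δ (toℕ i) (toℕ k) * f k) ≈ f i
  sum-δˡ zero    f = ≈-trans (+-cong (*-identityˡ (f zero))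
                                   (≈-trans (≈-sym (*-distribˡ-sum 0# (f ∘ suc))) (zeroˡ _)))
                           (+-identityʳ (f zero))
  sum-δˡ (suc i) f = ≈-trans (+-cong (zeroˡ (f zero)) (sum-δˡ i (f ∘ suc))) (+-identityˡ _)

  sum-δʳ : ∀ {n} (i : Fin n) (f : Fin n → Carrier) →
           sum (λ k → f k * δ (toℕ k) (toℕ i)) ≈ f i
  sum-δʳ zero    f = ≈-trans (+-cong (*-identityʳ (f zero))
                                   (≈-trans (≈-sym (*-distribʳ-sum 0# (f ∘ suc))) (zeroʳ _)))
                           (+-identityʳ (f zero))
  sum-δʳ (suc i) f = ≈-trans (+-cong (zeroʳ (f zero)) (sum-δʳ i (f ∘ suc))) (+-identityˡ _)

module ℚΣ = FiniteSums (CommutativeRing.semiring ℚP.+-*-commutativeRing)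
module ℤΣ = FiniteSums (CommutativeRing.semiring ℤP.+-*-commutativeRing)

-- ℤtoℚ is a ring homomorphism (computed through the normal form z / 1).
private
  ℤ/1 : ℤ → ℚ
  ℤ/1 z = mkℚ z 0 (Coprime.sym (Coprime.1-coprimeTo _))

  ℤtoℚ≡ℤ/1 : ∀ z → ℤtoℚ z ≡ ℤ/1 z
  ℤtoℚ≡ℤ/1 (+ n)    = ℚP.normalize-coprime (Coprime.sym (Coprime.1-coprimeTo _))
  ℤtoℚ≡ℤ/1 -[1+ n ] = cong ℚ.-_ (ℚP.normalize-coprime {suc n} (Coprime.sym (Coprime.1-coprimeTo _)))

ℤtoℚ-+ : ∀ a b → ℤtoℚ (a ℤ.+ b) ≡ ℤtoℚ a ℚ.+ ℤtoℚ b
ℤtoℚ-+ a b rewrite ℤtoℚ≡ℤ/1 a | ℤtoℚ≡ℤ/1 b =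
  cong (λ z → z ℚ./ 1) (cong₂ ℤ._+_ (sym (ℤP.*-identityʳ a)) (sym (ℤP.*-identityʳ b)))

ℤtoℚ-* : ∀ a b → ℤtoℚ (a ℤ.* b) ≡ ℤtoℚ a ℚ.* ℤtoℚ b
ℤtoℚ-* a b rewrite ℤtoℚ≡ℤ/1 a | ℤtoℚ≡ℤ/1 b = refl

ℤtoℚ-neg : ∀ a → ℤtoℚ (ℤ.- a) ≡ ℚ.- ℤtoℚ a
ℤtoℚ-neg a rewrite ℤtoℚ≡ℤ/1 a | ℤtoℚ≡ℤ/1 (ℤ.- a) with a
... | + zero   = refl
... | + suc n  = refl
... | -[1+ n ] = refl

ℤtoℚ-- : ∀ a b → ℤtoℚ (a ℤ.- b) ≡ ℤtoℚ a ℚ.- ℤtoℚ b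
ℤtoℚ-- a b = trans (ℤtoℚ-+ a (ℤ.- b)) (cong (ℤtoℚ a ℚ.+_) (ℤtoℚ-neg b))

ℤtoℚ-sum : ∀ {n} (f : Fin n → ℤ) → ℤtoℚ (ℤΣ.sum f) ≡ ℚΣ.sum (ℤtoℚ ∘ f)
ℤtoℚ-sum {zero}  f = refl
ℤtoℚ-sum {suc n} f = trans (ℤtoℚ-+ (f zero) _) (cong (ℤtoℚ (f zero) ℚ.+_) (ℤtoℚ-sum (f ∘ suc)))

Idℤ≡δ : ∀ {n} (i j : Fin n) → Idℤ i j ≡ ℤΣ.δ (toℕ i) (toℕ j)
Idℤ≡δ zero    zero    = refl
Idℤ≡δ zero    (suc j) = refl
Idℤ≡δ (suc i) zero    = refl
Idℤ≡δ (suc i) (suc j) = Idℤ≡δ i j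

ℤtoℚ-Idℤ : ∀ {n} (i j : Fin n) → ℤtoℚ (Idℤ i j) ≡ ℚΣ.δ (toℕ i) (toℕ j)
ℤtoℚ-Idℤ zero    zero    = refl
ℤtoℚ-Idℤ zero    (suc j) = refl
ℤtoℚ-Idℤ (suc i) zero    = refl
ℤtoℚ-Idℤ (suc i) (suc j) = ℤtoℚ-Idℤ i j

Σℤ≡sum : ∀ {n} (f : Fin n → ℤ) → Σℤ f ≡ ℤΣ.sum f
Σℤ≡sum {zero}  f = refl
Σℤ≡sum {suc n} f = cong (λ s → f zero ℤ.+ s) (Σℤ≡sum (f ∘ suc))

Σℤ-cong : ∀ {n} {f g : Fin n → ℤ} → (∀ k → f k ≡ g k) → Σℤ f ≡ Σℤ g
Σℤ-cong {zero}  f≡g = refl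
Σℤ-cong {suc n} f≡g = cong₂ ℤ._+_ (f≡g zero) (Σℤ-cong (f≡g ∘ suc))

·ℤ-sum : ∀ {n} (X Y : Matℤ n) i j → (X ·ℤ Y) i j ≡ ℤΣ.sum (λ k → X i k ℤ.* Y k j)
·ℤ-sum X Y i j = Σℤ≡sum (λ k → X i k ℤ.* Y k j)

·ℤ-congˡ : ∀ {n} {X X' : Matℤ n} (Y : Matℤ n) → (∀ i j → X i j ≡ X' i j) →
           ∀ i j → (X ·ℤ Y) i j ≡ (X' ·ℤ Y) i j
·ℤ-congˡ Y X≡X' i j = Σℤ-cong (λ k → cong (ℤ._* Y k j) (X≡X' i k))

·ℤ-congʳ : ∀ {n} (X : Matℤ n) {Y Y' : Matℤ n} → (∀ i j → Y i j ≡ Y' i j) →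
           ∀ i j → (X ·ℤ Y) i j ≡ (X ·ℤ Y') i j
·ℤ-congʳ X Y≡Y' i j = Σℤ-cong (λ k → cong (X i k ℤ.*_) (Y≡Y' k j))

·ℤ-assoc : ∀ {n} (X Y W : Matℤ n) i j → ((X ·ℤ Y) ·ℤ W) i j ≡ (X ·ℤ (Y ·ℤ W)) i j
·ℤ-assoc {n} X Y W i j = begin
  ((X ·ℤ Y) ·ℤ W) i j                                      ≡⟨ ·ℤ-sum (X ·ℤ Y) W i j ⟩
  ℤΣ.sum (λ k → (X ·ℤ Y) i k ℤ.* W k j)                    ≡⟨ ℤΣ.sum-cong-≗ {n} (λ k → cong (ℤ._* W k j) (·ℤ-sum X Y i k)) ⟩
  ℤΣ.sum (λ k → ℤΣ.sum (λ l → X i l ℤ.* Y l k) ℤ.* W k j)  ≡⟨ sym (ℤΣ.sum-reassoc (X i) Y (λ k → W k j)) ⟩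
  ℤΣ.sum (λ l → X i l ℤ.* ℤΣ.sum (λ k → Y l k ℤ.* W k j))  ≡⟨ ℤΣ.sum-cong-≗ {n} (λ l → cong (X i l ℤ.*_) (sym (·ℤ-sum Y W l j))) ⟩
  ℤΣ.sum (λ l → X i l ℤ.* (Y ·ℤ W) l j)                    ≡⟨ sym (·ℤ-sum X (Y ·ℤ W) i j) ⟩
  (X ·ℤ (Y ·ℤ W)) i j                                      ∎
  where open ≡-Reasoning

·ℤ-identityˡ : ∀ {n} (X : Matℤ n) i j → (Idℤ ·ℤ X) i j ≡ X i j
·ℤ-identityˡ {n} X i j = trans (·ℤ-sum Idℤ X i j)
  (trans (ℤΣ.sum-cong-≗ {n} (λ k → cong (ℤ._* X k j) (Idℤ≡δ i k))) (ℤΣ.sum-δˡ i (λ k → X k j)))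

·ℤ-identityʳ : ∀ {n} (X : Matℤ n) i j → (X ·ℤ Idℤ) i j ≡ X i j
·ℤ-identityʳ {n} X i j = trans (·ℤ-sum X Idℤ i j)
  (trans (ℤΣ.sum-cong-≗ {n} (λ k → cong (X i k ℤ.*_) (Idℤ≡δ k j))) (ℤΣ.sum-δʳ j (X i)))

InGL-from-inverses : ∀ {n} (B L R : Matℤ n) →
                     (∀ i j → (L ·ℤ B) i j ≡ Idℤ i j) → (∀ i j → (B ·ℤ R) i j ≡ Idℤ i j) →
                     InGL B
InGL-from-inverses B L R LB≡I BR≡I = R , BR≡I , RB≡I
  where
    open ≡-Reasoning

    R≡L : ∀ i j → R i j ≡ L i j
    R≡L i j = begin
      R i j                ≡⟨ sym (·ℤ-identityˡ R i j) ⟩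
      (Idℤ ·ℤ R) i j       ≡⟨ ·ℤ-congˡ R (λ a b → sym (LB≡I a b)) i j ⟩
      ((L ·ℤ B) ·ℤ R) i j  ≡⟨ ·ℤ-assoc L B R i j ⟩
      (L ·ℤ (B ·ℤ R)) i j  ≡⟨ ·ℤ-congʳ L BR≡I i j ⟩
      (L ·ℤ Idℤ) i j       ≡⟨ ·ℤ-identityʳ L i j ⟩
      L i j                ∎

    RB≡I : ∀ i j → (R ·ℤ B) i j ≡ Idℤ i j
    RB≡I i j = trans (·ℤ-congˡ B R≡L i j) (LB≡I i j)

Idℤ-sym : ∀ {n} (i j : Fin n) → Idℤ i j ≡ Idℤ j i
Idℤ-sym zero    zero    = refl
Idℤ-sym zero    (suc j) = refl
Idℤ-sym (suc i) zero    = refl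
Idℤ-sym (suc i) (suc j) = Idℤ-sym i j

left-inverse-from-transpose : ∀ {n} (B : Matℤ n) →
  (∃ λ C → ∀ i j → ((λ a b → B b a) ·ℤ C) i j ≡ Idℤ i j) →
  ∃ λ L → ∀ i j → (L ·ℤ B) i j ≡ Idℤ i j
left-inverse-from-transpose B (C , BᵀC≡I) = (λ i j → C j i) , λ i j →
  trans (Σℤ-cong (λ k → ℤP.*-comm (C k i) (B k j))) (trans (BᵀC≡I j i) (Idℤ-sym j i))

coeff-monic : ∀ {m} (f : Fin m → ℤ) k → coeff (monicPoly f) (toℕ k) ≡ f k
coeff-monic f zero    = refl
coeff-monic f (suc k) = coeff-monic (f ∘ suc) k

coeff-monic-lead : ∀ m (f : Fin m → ℤ) → coeff (monicPoly f) m ≡ + 1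
coeff-monic-lead zero    f = refl
coeff-monic-lead (suc m) f = coeff-monic-lead m (f ∘ suc)

coeff-monic-high : ∀ m (f : Fin m → ℤ) {n} → m ℕ.< n → coeff (monicPoly f) n ≡ + 0
coeff-monic-high zero    f {suc n} _             = refl
coeff-monic-high (suc m) f {suc n} (ℕ.s≤s m<n) = coeff-monic-high m (f ∘ suc) m<n

module QuotientAlgebra (D : ℕ) (c : Fin (suc D) → ℤ) where

  d : ℕ
  d = suc D

  T : K d → K d
  T = mulα c

  P : ℕ → K d → K d
  P = powα c

  infixl 7 _·_
  _·_ : K d → K d → K d
  x · y = mulK c x y

  K-setoid : Setoid 0ℓ 0ℓ
  K-setoid = record
    { Carrier       = K d
    ; _≈_           = _≋_
    ; isEquivalence = record
      { refl  = λ _ → refl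
      ; sym   = λ x≋y t → sym (x≋y t)
      ; trans = λ x≋y y≋z t → trans (x≋y t) (y≋z t) } }

  open Setoid K-setoid public using ()
    renaming (refl to ≋-refl; sym to ≋-sym; trans to ≋-trans)

  ΣK-pt : ∀ {n} (f : Fin n → K d) t → ΣK f t ≡ ℚΣ.sum (λ i → f i t)
  ΣK-pt {zero}  f t = refl
  ΣK-pt {suc n} f t = cong (f zero t ℚ.+_) (ΣK-pt (f ∘ suc) t)

  ΣK-cong : ∀ {n} {f g : Fin n → K d} → (∀ i → f i ≋ g i) → ΣK f ≋ ΣK g
  ΣK-cong {zero}  f≋g t = refl
  ΣK-cong {suc n} f≋g t = cong₂ ℚ._+_ (f≋g zero t) (ΣK-cong (f≋g ∘ suc) t)

  ΣK-+ : ∀ {n} (f g : Fin n → K d) → ΣK (λ i → f i +K g i) ≋ (ΣK f +K ΣK g)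
  ΣK-+ {n} f g t = begin
    ΣK (λ i → f i +K g i) t                     ≡⟨ ΣK-pt (λ i → f i +K g i) t ⟩
    ℚΣ.sum (λ i → f i t ℚ.+ g i t)              ≡⟨ ℚΣ.∑-distrib-+ (λ i → f i t) (λ i → g i t) ⟩
    ℚΣ.sum (λ i → f i t) ℚ.+ ℚΣ.sum (λ i → g i t) ≡⟨ sym (cong₂ ℚ._+_ (ΣK-pt f t) (ΣK-pt g t)) ⟩
    (ΣK f +K ΣK g) t                            ∎
    where open ≡-Reasoning

  •-congʳ : ∀ q {x y : K d} → x ≋ y → (q • x) ≋ (q • y)
  •-congʳ q x≋y t = cong (q ℚ.*_) (x≋y t)

  ΣK-comm : ∀ {m n} (f : Fin m → Fin n → K d) →
            ΣK (λ i → ΣK (f i)) ≋ ΣK (λ j → ΣK (λ i → f i j))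
  ΣK-comm {m} {n} f t = begin
    ΣK (λ i → ΣK (f i)) t               ≡⟨ ΣK-pt (λ i → ΣK (f i)) t ⟩
    ℚΣ.sum (λ i → ΣK (f i) t)           ≡⟨ ℚΣ.sum-cong-≗ {m} (λ i → ΣK-pt (f i) t) ⟩
    ℚΣ.sum (λ i → ℚΣ.sum (λ j → f i j t)) ≡⟨ ℚΣ.∑-comm (λ i j → f i j t) ⟩
    ℚΣ.sum (λ j → ℚΣ.sum (λ i → f i j t)) ≡⟨ ℚΣ.sum-cong-≗ {n} (λ j → sym (ΣK-pt (λ i → f i j) t)) ⟩
    ℚΣ.sum (λ j → ΣK (λ i → f i j) t)   ≡⟨ sym (ΣK-pt (λ j → ΣK (λ i → f i j)) t) ⟩
    ΣK (λ j → ΣK (λ i → f i j)) t       ∎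
    where open ≡-Reasoning

  sum-• : ∀ {n} (q : Fin n → ℚ) (y : K d) → (ℚΣ.sum q • y) ≋ ΣK (λ j → q j • y)
  sum-• q y t = trans (ℚΣ.*-distribʳ-sum (y t) q) (sym (ΣK-pt (λ j → q j • y) t))

  ΣK-regroup : ∀ {m n} (r : Fin m → Fin n → ℚ) (y : Fin n → K d) →
               ΣK (λ j → ΣK (λ i → r j i • y i)) ≋ ΣK (λ i → ℚΣ.sum (λ j → r j i) • y i)
  ΣK-regroup r y = ≋-trans (ΣK-comm (λ j i → r j i • y i))
                           (ΣK-cong (λ i → ≋-sym (sum-• (λ j → r j i) (y i))))

  record Linear (f : K d → K d) : Set where
    field
      ≋-cong : ∀ {x y} → x ≋ y → f x ≋ f y
      +-hom  : ∀ x y → f (x +K y) ≋ (f x +K f y)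
      •-hom  : ∀ q x → f (q • x) ≋ (q • f x)

    0-hom : f 0K ≋ 0K
    0-hom = ≋-trans (≋-cong {0K} {0ℚ • 0K} (λ _ → refl))
                    (≋-trans (•-hom 0ℚ 0K) (λ t → ℚP.*-zeroˡ (f 0K t)))

    Σ-hom : ∀ {n} (g : Fin n → K d) → f (ΣK g) ≋ ΣK (λ i → f (g i))
    Σ-hom {zero}  g = 0-hom
    Σ-hom {suc n} g t = trans (+-hom (g zero) (ΣK (g ∘ suc)) t)
                              (cong (f (g zero) t ℚ.+_) (Σ-hom (g ∘ suc) t))

    lc-hom : ∀ {n} (q : Fin n → ℚ) (g : Fin n → K d) →
             f (ΣK (λ i → q i • g i)) ≋ ΣK (λ i → q i • f (g i))
    lc-hom q g = ≋-trans (Σ-hom (λ i → q i • g i)) (ΣK-cong (λ i → •-hom (q i) (g i)))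

  open Linear public

  •-linear : ∀ q → Linear (q •_)
  •-linear q = record
    { ≋-cong = •-congʳ q
    ; +-hom  = λ x y t → ℚP.*-distribˡ-+ q (x t) (y t)
    ; •-hom  = λ r x t → trans (sym (ℚP.*-assoc q r (x t)))
                               (trans (cong (ℚ._* x t) (ℚP.*-comm q r)) (ℚP.*-assoc r q (x t)))
    }

  shiftK-cong : ∀ {x y : K d} → x ≋ y → shiftK x ≋ shiftK y
  shiftK-cong x≋y zero    = refl
  shiftK-cong x≋y (suc k) = x≋y (inject₁ k)

  shiftK-+ : ∀ (x y : K d) k → shiftK (x +K y) k ≡ shiftK x k ℚ.+ shiftK y k
  shiftK-+ x y zero    = refl
  shiftK-+ x y (suc k) = refl

  shiftK-• : ∀ q (x : K d) k → shiftK (q • x) k ≡ q ℚ.* shiftK x k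
  shiftK-• q x zero    = sym (ℚP.*-zeroʳ q)
  shiftK-• q x (suc k) = refl

  T-linear : Linear T
  T-linear = record
    { ≋-cong = λ x≋y k →
        cong₂ (λ s t → s ℚ.- t ℚ.* ℤtoℚ (c k)) (shiftK-cong x≋y k) (x≋y (fromℕ D))
    ; +-hom  = λ x y k → trans (cong (λ s → s ℚ.- top (x +K y) ℚ.* ℤtoℚ (c k)) (shiftK-+ x y k))
                               (reduce-+ (shiftK x k) (shiftK y k) (top x) (top y) (ℤtoℚ (c k)))
    ; •-hom  = λ q x k → trans (cong (λ s → s ℚ.- top (q • x) ℚ.* ℤtoℚ (c k)) (shiftK-• q x k))
                               (reduce-• q (shiftK x k) (top x) (ℤtoℚ (c k)))
    }
    where
      open +-*-Solver
      reduce-+ : ∀ a b s t e → (a ℚ.+ b) ℚ.- (s ℚ.+ t) ℚ.* e ≡ (a ℚ.- s ℚ.* e) ℚ.+ (b ℚ.- t ℚ.* e)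
      reduce-+ = solve 5 (λ a b s t e → (a :+ b) :- (s :+ t) :* e := (a :- s :* e) :+ (b :- t :* e)) refl
      reduce-• : ∀ q a s e → q ℚ.* a ℚ.- (q ℚ.* s) ℚ.* e ≡ q ℚ.* (a ℚ.- s ℚ.* e)
      reduce-• = solve 4 (λ q a s e → q :* a :- (q :* s) :* e := q :* (a :- s :* e)) refl

  P-linear : ∀ n → Linear (P n)
  P-linear zero    = record { ≋-cong = λ x≋y → x≋y ; +-hom = λ _ _ _ → refl ; •-hom = λ _ _ _ → refl }
  P-linear (suc n) = record
    { ≋-cong = ≋-cong T-linear ∘ ≋-cong (P-linear n)
    ; +-hom  = λ x y → ≋-trans (≋-cong T-linear (+-hom (P-linear n) x y)) (+-hom T-linear _ _)
    ; •-hom  = λ q x → ≋-trans (≋-cong T-linear (•-hom (P-linear n) q x)) (•-hom T-linear q _)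
    }

  P-T : ∀ n x → P n (T x) ≋ T (P n x)
  P-T zero    x = ≋-refl
  P-T (suc n) x = ≋-cong T-linear (P-T n x)

  ·-linearˡ : ∀ y → Linear (_· y)
  ·-linearˡ y = record
    { ≋-cong = λ x≋x' → ΣK-cong (λ k → •-congʳ (y k) (≋-cong (P-linear (toℕ k)) x≋x'))
    ; +-hom  = λ x x' → ≋-trans
        (ΣK-cong (λ k → ≋-trans (•-congʳ (y k) (+-hom (P-linear (toℕ k)) x x'))
                                (+-hom (•-linear (y k)) (P (toℕ k) x) (P (toℕ k) x'))))
        (ΣK-+ (λ k → y k • P (toℕ k) x) (λ k → y k • P (toℕ k) x'))
    ; •-hom  = λ q x → ≋-trans
        (ΣK-cong (λ k → ≋-trans (•-congʳ (y k) (•-hom (P-linear (toℕ k)) q x))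
                                (•-hom (•-linear (y k)) q (P (toℕ k) x))))
        (≋-sym (Σ-hom (•-linear q) (λ k → y k • P (toℕ k) x)))
    }

  ·-T : ∀ x y → (T x · y) ≋ T (x · y)
  ·-T x y = ≋-trans (ΣK-cong (λ k → •-congʳ (y k) (P-T (toℕ k) x)))
                    (≋-sym (lc-hom T-linear y (λ k → P (toℕ k) x)))

  ·-P : ∀ n x y → (P n x · y) ≋ P n (x · y)
  ·-P zero    x y = ≋-refl
  ·-P (suc n) x y = ≋-trans (·-T (P n x) y) (≋-cong T-linear (·-P n x y))

  -- (v a) b = (v b) a: the source of commutativity and associativity.
  ·-swap : ∀ v a b → ((v · a) · b) ≋ ((v · b) · a)
  ·-swap v a b = ≋-trans (lc-hom (·-linearˡ b) a (λ k → P (toℕ k) v))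
                         (ΣK-cong (λ k → •-congʳ (a k) (·-P (toℕ k) v b)))

  ê : ℕ → K d
  ê n t = ℚΣ.δ n (toℕ t)

  top-ê : ∀ {n} → n ℕ.< D → top (ê n) ≡ 0ℚ
  top-ê {n} n<D = trans (cong (ℚΣ.δ n) (toℕ-fromℕ D)) (ℚΣ.δ-< n<D)

  T-shift : ∀ x → top x ≡ 0ℚ → T x ≋ shiftK x
  T-shift x top≡0 k = trans (cong (λ s → shiftK x k ℚ.- s ℚ.* ℤtoℚ (c k)) top≡0)
                            (trans (cong (λ s → shiftK x k ℚ.- s) (ℚP.*-zeroˡ (ℤtoℚ (c k))))
                                   (ℚP.+-identityʳ (shiftK x k)))

  P-1K : ∀ n → n ℕ.≤ D → P n 1K ≋ ê n
  P-1K zero    _   zero    = refl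
  P-1K zero    _   (suc t) = refl
  P-1K (suc n) n<D = ≋-trans (≋-cong T-linear (P-1K n (ℕP.<⇒≤ n<D)))
                             (≋-trans (T-shift (ê n) (top-ê n<D)) shift-ê)
    where
      shift-ê : shiftK (ê n) ≋ ê (suc n)
      shift-ê zero    = refl
      shift-ê (suc t) = cong (ℚΣ.δ n) (toℕ-inject₁ t)

  -- 1 · y = Σ_k y_k α^k = y, since α^k is the k-th basis vector.
  ·-identityˡ : ∀ y → (1K · y) ≋ y
  ·-identityˡ y t = begin
    (1K · y) t                                     ≡⟨ ΣK-pt (λ k → y k • P (toℕ k) 1K) t ⟩
    ℚΣ.sum (λ k → y k ℚ.* P (toℕ k) 1K t)          ≡⟨ ℚΣ.sum-cong-≗ {d} (λ k → cong (y k ℚ.*_) (P-1K (toℕ k) (toℕ≤pred[n] k) t)) ⟩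
    ℚΣ.sum (λ k → y k ℚ.* ℚΣ.δ (toℕ k) (toℕ t))    ≡⟨ ℚΣ.sum-δʳ t y ⟩
    y t                                            ∎
    where open ≡-Reasoning

  ·-comm : ∀ x y → (x · y) ≋ (y · x)
  ·-comm x y = ≋-trans (≋-cong (·-linearˡ y) (≋-sym (·-identityˡ x)))
              (≋-trans (·-swap 1K x y) (≋-cong (·-linearˡ x) (·-identityˡ y)))

  ·-assoc : ∀ x y z → ((x · y) · z) ≋ (x · (y · z))
  ·-assoc x y z = ≋-sym (≋-trans (·-comm x (y · z))
                  (≋-trans (·-swap y z x) (≋-cong (·-linearˡ z) (·-comm y x))))

  ·-identityʳ : ∀ x → (x · 1K) ≋ x
  ·-identityʳ x = ≋-trans (·-comm x 1K) (·-identityˡ x)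

  ·-linearʳ : ∀ x → Linear (x ·_)
  ·-linearʳ x = record
    { ≋-cong = λ {y} {y'} y≋y' → ≋-trans (·-comm x y) (≋-trans (≋-cong (·-linearˡ x) y≋y') (·-comm y' x))
    ; +-hom  = λ y y' → ≋-trans (·-comm x _) (≋-trans (+-hom (·-linearˡ x) y y')
                          (λ t → cong₂ ℚ._+_ (·-comm y x t) (·-comm y' x t)))
    ; •-hom  = λ q y → ≋-trans (·-comm x _) (≋-trans (•-hom (·-linearˡ x) q y) (•-congʳ q (·-comm y x)))
    }

  ·-P-1K : ∀ n v → (v · P n 1K) ≋ P n v
  ·-P-1K n v = ≋-trans (·-comm v (P n 1K)) (≋-trans (·-P n 1K v) (≋-cong (P-linear n) (·-identityˡ v)))

  ·-rotate : ∀ g u v → (g · (u · v)) ≋ (v · (u · g))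
  ·-rotate g u v = ≋-trans (·-comm g (u · v)) (≋-trans (·-swap u v g) (·-comm (u · g) v))

  -- The dual basis of ℤ[α] for the pairing (x , y) ↦ top (x · y):
  -- dual k = Σ_s F_(k+1+s) α^s, where F_n is the coefficient of X^n in F.
  F : ℕ → ℤ
  F = coeff (monicPoly c)

  dual : ℕ → K d
  dual k s = ℤtoℚ (F (suc (k ℕ.+ toℕ s)))

  top-dual : ∀ k → top (dual k) ≡ ℚΣ.δ 0 k
  top-dual zero    = trans (cong (λ n → ℤtoℚ (F (suc n))) (toℕ-fromℕ D))
                           (cong ℤtoℚ (coeff-monic-lead d c))
  top-dual (suc k) = trans (cong (λ n → ℤtoℚ (F (suc (suc k ℕ.+ n)))) (toℕ-fromℕ D))
                           (cong ℤtoℚ (coeff-monic-high d c (ℕ.s≤s (ℕ.s≤s (ℕP.m≤n+m D k)))))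

  T-dual-suc : ∀ k → T (dual (suc k)) ≋ (dual k +K ((ℚ.- ℤtoℚ (F (suc k))) • ê 0))
  T-dual-suc k = ≋-trans (T-shift (dual (suc k)) (top-dual (suc k))) shifted
    where
      open +-*-Solver
      a : ℚ
      a = ℤtoℚ (F (suc k))

      shifted : shiftK (dual (suc k)) ≋ (dual k +K ((ℚ.- a) • ê 0))
      shifted zero    = sym (trans (cong (λ n → ℤtoℚ (F (suc n)) ℚ.+ (ℚ.- a) ℚ.* 1ℚ) (ℕP.+-identityʳ k))
                                   (solve 1 (λ a → a :+ (:- a) :* con 1ℚ := con 0ℚ) refl a))
      shifted (suc s) = trans (cong (λ n → ℤtoℚ (F (suc n)))
                                    (trans (cong (λ n → suc (k ℕ.+ n)) (toℕ-inject₁ s)) (sym (ℕP.+-suc k (toℕ s)))))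
                              (sym (solve 2 (λ b a → b :+ (:- a) :* con 0ℚ := b) refl (dual k (suc s)) a))

  T-dual-zero : T (dual 0) ≋ ((ℚ.- ℤtoℚ (c zero)) • ê 0)
  T-dual-zero zero    = trans (cong (λ t → 0ℚ ℚ.- t ℚ.* ℤtoℚ (c zero)) (top-dual 0))
                              (solve 1 (λ a → con 0ℚ :- con 1ℚ :* a := (:- a) :* con 1ℚ) refl (ℤtoℚ (c zero)))
    where open +-*-Solver
  T-dual-zero (suc s) = trans (cong₂ (λ b t → b ℚ.- t ℚ.* ℤtoℚ (c (suc s)))
                                     (trans (cong (λ n → ℤtoℚ (F (suc n))) (toℕ-inject₁ s))
                                            (cong ℤtoℚ (coeff-monic c (suc s))))
                                     (top-dual 0))
                              (solve 2 (λ b a → b :- con 1ℚ :* b := (:- a) :* con 0ℚ) refl (ℤtoℚ (c (suc s))) (ℤtoℚ (c zero)))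
    where open +-*-Solver

  top-cong : ∀ {x y : K d} → x ≋ y → top x ≡ top y
  top-cong x≋y = x≋y (fromℕ D)

  top-P-ê0 : ∀ {l} → l ℕ.< D → top (P l (ê 0)) ≡ 0ℚ
  top-P-ê0 {l} l<D = trans (top-cong (≋-cong (P-linear l) (≋-sym (P-1K 0 ℕ.z≤n))))
                           (trans (top-cong (P-1K l (ℕP.<⇒≤ l<D))) (top-ê l<D))

  top-P-dual : ∀ l → l ℕ.≤ D → ∀ k → top (P l (dual k)) ≡ ℚΣ.δ l k
  top-P-dual zero    _   k       = top-dual k
  top-P-dual (suc l) l<D (suc k) = begin
    top (T (P l (dual (suc k))))                     ≡⟨ top-cong (≋-sym (P-T l (dual (suc k)))) ⟩
    top (P l (T (dual (suc k))))                     ≡⟨ top-cong (≋-cong (P-linear l) (T-dual-suc k)) ⟩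
    top (P l (dual k +K (q • ê 0)))                  ≡⟨ top-cong (+-hom (P-linear l) (dual k) (q • ê 0)) ⟩
    top (P l (dual k)) ℚ.+ top (P l (q • ê 0))       ≡⟨ cong₂ ℚ._+_ (top-P-dual l (ℕP.<⇒≤ l<D) k)
                                                                   (top-cong (•-hom (P-linear l) q (ê 0))) ⟩
    ℚΣ.δ l k ℚ.+ q ℚ.* top (P l (ê 0))              ≡⟨ cong (λ t → ℚΣ.δ l k ℚ.+ q ℚ.* t) (top-P-ê0 l<D) ⟩
    ℚΣ.δ l k ℚ.+ q ℚ.* 0ℚ                           ≡⟨ cong (ℚΣ.δ l k ℚ.+_) (ℚP.*-zeroʳ q) ⟩
    ℚΣ.δ l k ℚ.+ 0ℚ                                 ≡⟨ ℚP.+-identityʳ (ℚΣ.δ l k) ⟩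
    ℚΣ.δ l k                                        ∎
    where
      open ≡-Reasoning
      q : ℚ
      q = ℚ.- ℤtoℚ (F (suc k))
  top-P-dual (suc l) l<D zero = begin
    top (T (P l (dual 0)))   ≡⟨ top-cong (≋-sym (P-T l (dual 0))) ⟩
    top (P l (T (dual 0)))   ≡⟨ top-cong (≋-cong (P-linear l) T-dual-zero) ⟩
    top (P l (q • ê 0))      ≡⟨ top-cong (•-hom (P-linear l) q (ê 0)) ⟩
    q ℚ.* top (P l (ê 0))    ≡⟨ cong (q ℚ.*_) (top-P-ê0 l<D) ⟩
    q ℚ.* 0ℚ                 ≡⟨ ℚP.*-zeroʳ q ⟩
    0ℚ                       ∎
    where
      open ≡-Reasoning
      q : ℚ
      q = ℚ.- ℤtoℚ (c zero)

  top-dual-· : ∀ k y → top (dual (toℕ k) · y) ≡ y k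
  top-dual-· k y = begin
    top (dual (toℕ k) · y)                                ≡⟨ ΣK-pt (λ l → y l • P (toℕ l) (dual (toℕ k))) (fromℕ D) ⟩
    ℚΣ.sum (λ l → y l ℚ.* top (P (toℕ l) (dual (toℕ k)))) ≡⟨ ℚΣ.sum-cong-≗ {d} (λ l →
                                                               cong (y l ℚ.*_) (top-P-dual (toℕ l) (toℕ≤pred[n] l) (toℕ k))) ⟩
    ℚΣ.sum (λ l → y l ℚ.* ℚΣ.δ (toℕ l) (toℕ k))           ≡⟨ ℚΣ.sum-δʳ k y ⟩
    y k                                                   ∎
    where open ≡-Reasoning

  IsInteger : ℚ → Set
  IsInteger q = ∃ λ z → q ≡ ℤtoℚ z

  integer-+ : ∀ {a b} → IsInteger a → IsInteger b → IsInteger (a ℚ.+ b)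
  integer-+ (x , a≡x) (y , b≡y) = x ℤ.+ y , trans (cong₂ ℚ._+_ a≡x b≡y) (sym (ℤtoℚ-+ x y))

  integer-* : ∀ {a b} → IsInteger a → IsInteger b → IsInteger (a ℚ.* b)
  integer-* (x , a≡x) (y , b≡y) = x ℤ.* y , trans (cong₂ ℚ._*_ a≡x b≡y) (sym (ℤtoℚ-* x y))

  integer-- : ∀ {a b} → IsInteger a → IsInteger b → IsInteger (a ℚ.- b)
  integer-- (x , a≡x) (y , b≡y) = x ℤ.- y , trans (cong₂ ℚ._-_ a≡x b≡y) (sym (ℤtoℚ-- x y))

  InZα-coords : ∀ {x : K d} → (∀ k → IsInteger (x k)) → InZα x
  InZα-coords integral = (λ k → proj₁ (integral k)) , (λ k → proj₂ (integral k))

  coord-integer : ∀ {x : K d} → InZα x → ∀ k → IsInteger (x k)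
  coord-integer (z , x≡z) k = z k , x≡z k

  InZα-≋ : ∀ {x y : K d} → x ≋ y → InZα x → InZα y
  InZα-≋ x≋y (z , x≡z) = z , (λ k → trans (sym (x≋y k)) (x≡z k))

  InZα-1K : InZα 1K
  InZα-1K = InZα-coords λ { zero → + 1 , refl ; (suc k) → + 0 , refl }

  InZα-T : ∀ {x} → InZα x → InZα (T x)
  InZα-T {x} x∈ℤ[α] = InZα-coords λ k →
    integer-- (shifted k) (integer-* (coord-integer x∈ℤ[α] (fromℕ D)) (c k , refl))
    where
      shifted : ∀ k → IsInteger (shiftK x k)
      shifted zero    = + 0 , refl
      shifted (suc k) = coord-integer x∈ℤ[α] (inject₁ k)

  InZα-P : ∀ n {x} → InZα x → InZα (P n x)
  InZα-P zero    x∈ℤ[α] = x∈ℤ[α]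
  InZα-P (suc n) x∈ℤ[α] = InZα-T (InZα-P n x∈ℤ[α])

  InZα-ΣK : ∀ {n} (f : Fin n → K d) → (∀ i → InZα (f i)) → InZα (ΣK f)
  InZα-ΣK {zero}  f _        = InZα-coords (λ k → + 0 , refl)
  InZα-ΣK {suc n} f integral = InZα-coords λ k →
    integer-+ (coord-integer (integral zero) k) (coord-integer (InZα-ΣK (f ∘ suc) (integral ∘ suc)) k)

  InZα-• : ∀ {q x} → IsInteger q → InZα x → InZα (q • x)
  InZα-• q∈ℤ x∈ℤ[α] = InZα-coords (λ k → integer-* q∈ℤ (coord-integer x∈ℤ[α] k))

  InZα-· : ∀ {x y} → InZα x → InZα y → InZα (x · y)
  InZα-· {x} {y} x∈ℤ[α] y∈ℤ[α] =
    InZα-ΣK (λ k → y k • P (toℕ k) x) (λ k → InZα-• (coord-integer y∈ℤ[α] k) (InZα-P (toℕ k) x∈ℤ[α]))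

  InZα-dual : ∀ k → InZα (dual k)
  InZα-dual k = InZα-coords (λ s → F (suc (k ℕ.+ toℕ s)) , refl)

  lc : ∀ {n} → (Fin n → K d) → (Fin n → ℤ) → K d
  lc γ z = ΣK (λ i → ℤtoℚ (z i) • γ i)

  lc-cong : ∀ {n} (γ : Fin n → K d) {z z'} → (∀ i → z i ≡ z' i) → lc γ z ≋ lc γ z'
  lc-cong γ z≡z' = ΣK-cong (λ i t → cong (λ a → ℤtoℚ a ℚ.* γ i t) (z≡z' i))

  lc-+ : ∀ {n} (γ : Fin n → K d) z z' → lc γ (λ i → z i ℤ.+ z' i) ≋ (lc γ z +K lc γ z')
  lc-+ γ z z' = ≋-trans (ΣK-cong (λ i t → trans (cong (ℚ._* γ i t) (ℤtoℚ-+ (z i) (z' i)))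
                                               (ℚP.*-distribʳ-+ (γ i t) (ℤtoℚ (z i)) (ℤtoℚ (z' i)))))
                        (ΣK-+ (λ i → ℤtoℚ (z i) • γ i) (λ i → ℤtoℚ (z' i) • γ i))

  InSpan-≋ : ∀ {n} {γ : Fin n → K d} {x y} → x ≋ y → InSpan γ x → InSpan γ y
  InSpan-≋ x≋y (z , x≋lc) = z , ≋-trans (≋-sym x≋y) x≋lc

  InSpan-Σ : ∀ {m n} (γ : Fin n → K d) (f : Fin m → K d) → (∀ i → InSpan γ (f i)) → InSpan γ (ΣK f)
  InSpan-Σ {zero}  γ f _ = (λ _ → + 0) , λ t → sym (trans (ΣK-pt (λ i → 0ℚ • γ i) t)
                             (trans (sym (ℚΣ.*-distribˡ-sum 0ℚ (λ i → γ i t))) (ℚP.*-zeroˡ (ℚΣ.sum (λ i → γ i t)))))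
  InSpan-Σ {suc m} γ f spanned
    with spanned zero | InSpan-Σ γ (f ∘ suc) (spanned ∘ suc)
  ... | z , f0≋ | z' , rest≋ = (λ i → z i ℤ.+ z' i) , ≋-trans (λ t → cong₂ ℚ._+_ (f0≋ t) (rest≋ t)) (≋-sym (lc-+ γ z z'))

  member-coords : ∀ {n} (γ : Fin n → K d) i → γ i ≋ lc γ (Idℤ i)
  member-coords {n} γ i t = sym (begin
    lc γ (Idℤ i) t                                    ≡⟨ ΣK-pt (λ l → ℤtoℚ (Idℤ i l) • γ l) t ⟩
    ℚΣ.sum (λ l → ℤtoℚ (Idℤ i l) ℚ.* γ l t)           ≡⟨ ℚΣ.sum-cong-≗ {n} (λ l → cong (ℚ._* γ l t) (ℤtoℚ-Idℤ i l)) ⟩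
    ℚΣ.sum (λ l → ℚΣ.δ (toℕ i) (toℕ l) ℚ.* γ l t)     ≡⟨ ℚΣ.sum-δˡ i (λ l → γ l t) ⟩
    γ i t                                             ∎)
    where open ≡-Reasoning

  member : ∀ {n} (γ : Fin n → K d) i → InSpan γ (γ i)
  member γ i = Idℤ i , member-coords γ i

  lc-unique : ∀ {n} (γ : Fin n → K d) → ZIndependent γ → ∀ {z z'} → lc γ z ≋ lc γ z' → ∀ i → z i ≡ z' i
  lc-unique {n} γ indep {z} {z'} lc≋lc i = ℤP.i-j≡0⇒i≡j (z i) (z' i) (indep w lc-w≋0 i)
    where
      open +-*-Solver
      w : Fin n → ℤ
      w i = z i ℤ.- z' i

      minus-plus : ∀ a b → (a ℤ.- b) ℤ.+ b ≡ a
      minus-plus a b = trans (ℤP.+-assoc a (ℤ.- b) b)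
                             (trans (cong (λ s → a ℤ.+ s) (ℤP.+-inverseˡ b)) (ℤP.+-identityʳ a))

      lc-w≋0 : lc γ w ≋ 0K
      lc-w≋0 t = begin
        lc γ w t                                 ≡⟨ solve 2 (λ a b → a := (a :+ b) :- b) refl (lc γ w t) (lc γ z' t) ⟩
        (lc γ w t ℚ.+ lc γ z' t) ℚ.- lc γ z' t   ≡⟨ cong (ℚ._- lc γ z' t) (sym (lc-+ γ w z' t)) ⟩
        lc γ (λ i → w i ℤ.+ z' i) t ℚ.- lc γ z' t ≡⟨ cong (ℚ._- lc γ z' t)
                                                      (trans (lc-cong γ (λ i → minus-plus (z i) (z' i)) t) (lc≋lc t)) ⟩
        lc γ z' t ℚ.- lc γ z' t                  ≡⟨ ℚP.+-inverseʳ (lc γ z' t) ⟩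
        0ℚ                                       ∎
        where open ≡-Reasoning

  top-ΣK-· : ∀ {n} (f : Fin n → K d) y → top (ΣK f · y) ≡ ℚΣ.sum (λ i → top (f i · y))
  top-ΣK-· f y = trans (top-cong (Σ-hom (·-linearˡ y) f)) (ΣK-pt (λ i → f i · y) (fromℕ D))

  top-lc-· : ∀ {n} (γ : Fin n → K d) z y → top (lc γ z · y) ≡ ℚΣ.sum (λ i → ℤtoℚ (z i) ℚ.* top (γ i · y))
  top-lc-· γ z y = trans (top-cong (lc-hom (·-linearˡ y) (ℤtoℚ ∘ z) γ))
                         (ΣK-pt (λ i → ℤtoℚ (z i) • (γ i · y)) (fromℕ D))

  -- If v ℤ[α] ⊆ span γ, multiplication by v is read off in the coordinates
  -- of γ by integral functionals: there are φ_m ∈ ℤ[α] with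
  -- v g = Σ_m top (φ_m g) γ_m for all g ∈ K.  (φ_m = Σ_k A_km dual_k, where
  -- A_k are the coordinates of α^k v.)
  Represents : ∀ {n} → (Fin n → K d) → K d → (Fin n → K d) → Set
  Represents γ v φ = (∀ m → InZα (φ m)) × (∀ g → (v · g) ≋ ΣK (λ m → top (φ m · g) • γ m))

  coordinate-functionals : ∀ {n} (γ : Fin n → K d) (v : K d) →
    (∀ r → InZα r → InSpan γ (v · r)) → ∃ (Represents γ v)
  coordinate-functionals {n} γ v v-mod = φ , φ-integral , expansion
    where
      αᵏv-span : ∀ (k : Fin d) → InSpan γ (P (toℕ k) v)
      αᵏv-span k = InSpan-≋ (·-P-1K (toℕ k) v) (v-mod (P (toℕ k) 1K) (InZα-P (toℕ k) InZα-1K))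

      A : Fin d → Fin n → ℤ
      A k = proj₁ (αᵏv-span k)

      φ : Fin n → K d
      φ m = ΣK (λ k → ℤtoℚ (A k m) • dual (toℕ k))

      φ-integral : ∀ m → InZα (φ m)
      φ-integral m = InZα-ΣK (λ k → ℤtoℚ (A k m) • dual (toℕ k)) (λ k → InZα-• (A k m , refl) (InZα-dual (toℕ k)))

      top-φ : ∀ m g → top (φ m · g) ≡ ℚΣ.sum (λ k → g k ℚ.* ℤtoℚ (A k m))
      top-φ m g = trans (top-lc-· (dual ∘ toℕ) (λ k → A k m) g)
                        (ℚΣ.sum-cong-≗ {d} (λ k → trans (cong (ℤtoℚ (A k m) ℚ.*_) (top-dual-· k g))
                                                        (ℚP.*-comm (ℤtoℚ (A k m)) (g k))))

      expansion : ∀ g → (v · g) ≋ ΣK (λ m → top (φ m · g) • γ m)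
      expansion g t = begin
        (v · g) t                                                   ≡⟨ ΣK-pt (λ k → g k • P (toℕ k) v) t ⟩
        ℚΣ.sum (λ k → g k ℚ.* P (toℕ k) v t)                        ≡⟨ ℚΣ.sum-cong-≗ {d} (λ k →
                                                                         cong (g k ℚ.*_) (trans (proj₂ (αᵏv-span k) t)
                                                                                                (ΣK-pt (λ m → ℤtoℚ (A k m) • γ m) t))) ⟩
        ℚΣ.sum (λ k → g k ℚ.* ℚΣ.sum (λ m → ℤtoℚ (A k m) ℚ.* γ m t)) ≡⟨ ℚΣ.sum-reassoc g (λ k m → ℤtoℚ (A k m)) (λ m → γ m t) ⟩
        ℚΣ.sum (λ m → ℚΣ.sum (λ k → g k ℚ.* ℤtoℚ (A k m)) ℚ.* γ m t) ≡⟨ ℚΣ.sum-cong-≗ {n} (λ m → cong (ℚ._* γ m t) (sym (top-φ m g))) ⟩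
        ℚΣ.sum (λ m → top (φ m · g) ℚ.* γ m t)                       ≡⟨ sym (ΣK-pt (λ m → top (φ m · g) • γ m) t) ⟩
        ΣK (λ m → top (φ m · g) • γ m) t                             ∎
        where open ≡-Reasoning

  -- Let γ be ℤ-independent and 1 = Σ_j u_j v_j with
  -- ℤ[α] u_j ⊆ span γ' and v_j ℤ[α] ⊆ span γ.  Then the pairing matrix
  -- B_li = top (γ'_i γ_l) has a right inverse C: the elements
  -- x_m = Σ_j φ_jm u_j ∈ span γ' (φ_j from coordinate-functionals for v_j)
  -- satisfy γ_l = Σ_m top (x_m γ_l) γ_m, so top (x_m γ_l) = (B C)_lm = δ_lm.
  pairing-right-inverse : ∀ {n} (γ γ' : Fin d → K d) (u v : Fin n → K d) (B : Matℤ d) →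
    ZIndependent γ →
    1K ≋ ΣK (λ j → u j · v j) →
    (∀ j r → InZα r → InSpan γ' (r · u j)) →
    (∀ j r → InZα r → InSpan γ (v j · r)) →
    (∀ l i → ℤtoℚ (B l i) ≡ top (γ' i · γ l)) →
    ∃ λ C → ∀ l m → (B ·ℤ C) l m ≡ Idℤ l m
  pairing-right-inverse {n} γ γ' u v B indep unit u-mod v-mod B≡ = C , BC≡I
    where
      functionals : ∀ j → ∃ (Represents γ (v j))
      functionals j = coordinate-functionals γ (v j) (v-mod j)

      φ : Fin n → Fin d → K d
      φ j = proj₁ (functionals j)

      x : Fin d → K d
      x m = ΣK (λ j → φ j m · u j)

      x-span : ∀ m → InSpan γ' (x m)
      x-span m = InSpan-Σ γ' (λ j → φ j m · u j) (λ j → u-mod j (φ j m) (proj₁ (proj₂ (functionals j)) m))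

      C : Matℤ d
      C i m = proj₁ (x-span m) i

      top-x : ∀ l m → top (x m · γ l) ≡ ℤtoℚ ((B ·ℤ C) l m)
      top-x l m = begin
        top (x m · γ l)                                      ≡⟨ top-cong (≋-cong (·-linearˡ (γ l)) (proj₂ (x-span m))) ⟩
        top (lc γ' (λ i → C i m) · γ l)                      ≡⟨ top-lc-· γ' (λ i → C i m) (γ l) ⟩
        ℚΣ.sum (λ i → ℤtoℚ (C i m) ℚ.* top (γ' i · γ l))     ≡⟨ ℚΣ.sum-cong-≗ {d} (λ i →
                                                                  trans (cong (ℤtoℚ (C i m) ℚ.*_) (sym (B≡ l i)))
                                                                        (sym (ℤtoℚ-* (C i m) (B l i)))) ⟩
        ℚΣ.sum (λ i → ℤtoℚ (C i m ℤ.* B l i))                ≡⟨ sym (ℤtoℚ-sum (λ i → C i m ℤ.* B l i)) ⟩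
        ℤtoℚ (ℤΣ.sum (λ i → C i m ℤ.* B l i))                ≡⟨ cong ℤtoℚ (ℤΣ.sum-cong-≗ {d} (λ i → ℤP.*-comm (C i m) (B l i))) ⟩
        ℤtoℚ (ℤΣ.sum (λ i → B l i ℤ.* C i m))                ≡⟨ cong ℤtoℚ (sym (·ℤ-sum B C l m)) ⟩
        ℤtoℚ ((B ·ℤ C) l m)                                  ∎
        where open ≡-Reasoning

      expansion : ∀ l → γ l ≋ lc γ ((B ·ℤ C) l)
      expansion l = begin
        γ l                                                        ≈⟨ ≋-sym (·-identityʳ (γ l)) ⟩
        γ l · 1K                                                   ≈⟨ ≋-cong (·-linearʳ (γ l)) unit ⟩
        γ l · ΣK (λ j → u j · v j)                                 ≈⟨ Σ-hom (·-linearʳ (γ l)) (λ j → u j · v j) ⟩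
        ΣK (λ j → γ l · (u j · v j))                               ≈⟨ ΣK-cong (λ j → ·-rotate (γ l) (u j) (v j)) ⟩
        ΣK (λ j → v j · (u j · γ l))                               ≈⟨ ΣK-cong (λ j → proj₂ (proj₂ (functionals j)) (u j · γ l)) ⟩
        ΣK (λ j → ΣK (λ m → top (φ j m · (u j · γ l)) • γ m))      ≈⟨ ΣK-regroup (λ j m → top (φ j m · (u j · γ l))) γ ⟩
        ΣK (λ m → ℚΣ.sum (λ j → top (φ j m · (u j · γ l))) • γ m)  ≈⟨ ΣK-cong (λ m t → cong (ℚ._* γ m t) (top-x-sum m)) ⟩
        lc γ ((B ·ℤ C) l)                                          ∎
        where
          open SetoidReasoning K-setoid
          top-x-sum : ∀ m → ℚΣ.sum (λ j → top (φ j m · (u j · γ l))) ≡ ℤtoℚ ((B ·ℤ C) l m)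
          top-x-sum m = trans (ℚΣ.sum-cong-≗ {n} (λ j → top-cong (≋-sym (·-assoc (φ j m) (u j) (γ l)))))
                              (trans (sym (top-ΣK-· (λ j → φ j m · u j) (γ l))) (top-x l m))

      BC≡I : ∀ l m → (B ·ℤ C) l m ≡ Idℤ l m
      BC≡I l = lc-unique γ indep (≋-trans (≋-sym (expansion l)) (member-coords γ l))

  -- I⁻¹ = span β' is a ℤ[α]-module: (r x) y = r (x y) ∈ ℤ[α] for y ∈ I.
  inverse-ideal-closed : ∀ {β β'} → IsInverseBasis c β β' →
                         ∀ r {x} → InZα r → InSpan β' x → InSpan β' (r · x)
  inverse-ideal-closed (_ , inverse-integral , inverse-maximal) r {x} r∈ℤ[α] x∈I⁻¹ =
    inverse-maximal (r · x) λ y y∈I →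
      InZα-≋ (≋-sym (·-assoc r x y)) (InZα-· r∈ℤ[α] (inverse-integral x x∈I⁻¹ y y∈I))

  module InvertibleIdeal (β β' : Fin d → K d) (β-basis : IsIntegralIdealBasis c β)
                         (β'-basis : IsInverseBasis c β β') (invertible : IsInvertible c β β') where

    private
      β-ideal : ∀ r x → InZα r → InSpan β x → InSpan β (r · x)
      β-ideal = proj₂ (proj₂ β-basis)

    products-integral : ∀ i l → InZα (β' i · β l)
    products-integral i l = proj₁ (proj₂ β'-basis) (β' i) (member β' i) (β l) (member β l)

    B : Matℤ d
    B l i = proj₁ (products-integral i l) (fromℕ D)

    B-entries : ∀ l i → ℤtoℚ (B l i) ≡ top (β' i · β l)
    B-entries l i = sym (proj₂ (products-integral i l) (fromℕ D))

    w : Matℤ d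
    w = proj₁ (proj₁ (invertible 1K) InZα-1K)

    w-unit : 1K ≋ ΣK (λ i → ΣK (λ j → ℤtoℚ (w i j) • (β' i · β j)))
    w-unit = proj₂ (proj₁ (invertible 1K) InZα-1K)

    -- Grouping by j, 1 = Σ_j u_j β_j with u_j = Σ_i w_ij β'_i ∈ I⁻¹.
    right-inverse : ∃ λ R → ∀ l m → (B ·ℤ R) l m ≡ Idℤ l m
    right-inverse = pairing-right-inverse β β' u β B (proj₁ β-basis) unit u-mod v-mod B-entries
      where
        u : Fin d → K d
        u j = lc β' (λ i → w i j)

        unit : 1K ≋ ΣK (λ j → u j · β j)
        unit = ≋-trans w-unit (≋-trans (ΣK-comm (λ i j → ℤtoℚ (w i j) • (β' i · β j)))
                 (ΣK-cong (λ j → ≋-sym (lc-hom (·-linearˡ (β j)) (λ i → ℤtoℚ (w i j)) β'))))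

        u-mod : ∀ j r → InZα r → InSpan β' (r · u j)
        u-mod j r r∈ℤ[α] = inverse-ideal-closed {β} {β'} β'-basis r r∈ℤ[α] ((λ i → w i j) , ≋-refl)

        v-mod : ∀ j r → InZα r → InSpan β (β j · r)
        v-mod j r r∈ℤ[α] = InSpan-≋ {γ = β} (·-comm r (β j)) (β-ideal r (β j) r∈ℤ[α] (member β j))

    -- Grouping by i, 1 = Σ_i u_i β'_i with u_i = Σ_j w_ij β_j ∈ I: the same
    -- lemma with I and I⁻¹ exchanged gives a right inverse of the transpose.
    left-inverse : ∃ λ L → ∀ i j → (L ·ℤ B) i j ≡ Idℤ i j
    left-inverse = left-inverse-from-transpose B
      (pairing-right-inverse β' β u β' Bᵀ (proj₁ β'-basis) unit u-mod v-mod Bᵀ-entries)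
      where
        Bᵀ : Matℤ d
        Bᵀ l i = B i l

        Bᵀ-entries : ∀ l i → ℤtoℚ (Bᵀ l i) ≡ top (β i · β' l)
        Bᵀ-entries l i = trans (B-entries i l) (top-cong (·-comm (β' l) (β i)))

        u : Fin d → K d
        u i = lc β (w i)

        unit : 1K ≋ ΣK (λ i → u i · β' i)
        unit = ≋-trans w-unit (ΣK-cong λ i →
                 ≋-trans (ΣK-cong (λ j → •-congʳ (ℤtoℚ (w i j)) (·-comm (β' i) (β j))))
                         (≋-sym (lc-hom (·-linearˡ (β' i)) (ℤtoℚ ∘ w i) β)))

        u-mod : ∀ i r → InZα r → InSpan β (r · u i)
        u-mod i r r∈ℤ[α] = β-ideal r (u i) r∈ℤ[α] (w i , ≋-refl)

        v-mod : ∀ i r → InZα r → InSpan β' (β' i · r)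
        v-mod i r r∈ℤ[α] = InSpan-≋ {γ = β'} (·-comm r (β' i)) (inverse-ideal-closed {β} {β'} β'-basis r r∈ℤ[α] (member β' i))

    B-invertible : InGL B
    B-invertible = InGL-from-inverses B (proj₁ left-inverse) (proj₁ right-inverse)
                                        (proj₂ left-inverse) (proj₂ right-inverse)

lemma1 : (d : ℕ) → 2 ≤ d → (c : Fin d → ℤ) → Irreducible (monicPoly c) →
         (β β' : Fin d → K d) →
         IsIntegralIdealBasis c β → IsInverseBasis c β β' → IsInvertible c β β' →
         ∃ λ (B : Matℤ d) →
           (∀ j i → ℤtoℚ (B j i) ≡ top (mulK c (β' i) (β j))) × InGL B
lemma1 zero    ()
lemma1 (suc D) _ c _ β β' β-basis β'-basis invertible = B , B-entries , B-invertible
  where open QuotientAlgebra.InvertibleIdeal D c β β' β-basis β'-basis invertible
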